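{- Let $p$ be an odd prime and let $q>3$ be a prime such that $q \mid p^2+p+1$. Then $|p-q| > \sqrt{3p}-2$. -}

module Defs where

module Submission where

-- Write Φ₃(x) = x² + x + 1.  For primes p and q with q ∣ Φ₃(p) we show
-- 3p < (|p - q| + 2)², i.e. |p - q| > √(3p) - 2.
--
-- The argument reduces Φ₃(p) modulo q and then uses a size bound:
--   * Φ₃(x) is always odd, so a proper divisor q of Φ₃(x) has cofactor ≥ 3,
--     i.e. 3q ≤ Φ₃(x) unless Φ₃(x) = q.
--   * If p = q + d then p ≡ d (mod q), so q ∣ Φ₃(d).  If Φ₃(d) = q then
--     p = (d + 1)², which is not prime; hence 3q ≤ Φ₃(d), giving
--     3p = 3q + 3d ≤ Φ₃(d) + 3d < (d + 2)².
--   * If q = p + d with d = k + 1 then p ≡ -(k + 1) (mod q) and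
--     Φ₃(-(k + 1)) = Φ₃(k), so q ∣ Φ₃(k).  If Φ₃(k) = q then p = k², not
--     prime; hence 3p < 3q ≤ Φ₃(k) < (d + 2)².
--   * p = q is impossible since p ∣ Φ₃(p) forces p ∣ 1.
-- The main theorem splits on the trichotomy of p and q.

open import Defs
open import Data.Nat using (ℕ; _+_; _*_; _<_; ∣_-_∣)
open import Data.Nat.Divisibility using (_∣_)
open import Data.Nat.Primality using (Prime)
open import Relation.Nullary using (¬_)

open import Data.Nat using (zero; suc; _≤_; z≤n; s≤s; compare; less; equal; greater)
open import Data.Nat.Properties
open import Data.Nat.Divisibility using (divides; ∣m+n∣m⇒∣n; ∣m∣n⇒∣m+n; m∣m*n; n∣m*n; ∣-refl; ∣1⇒≡1)
open import Data.Nat.Primality using (prime⇒irreducible; prime⇒nonTrivial)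
open import Data.Sum using (inj₁; inj₂)
open import Data.Empty using (⊥-elim)
open import Relation.Binary.PropositionalEquality
open import Data.Nat.Tactic.RingSolver using (solve-∀; solve)
open import Data.List using (_∷_; [])

Φ₃ : ℕ → ℕ
Φ₃ x = x * x + x + 1

-- Φ₃ increases by an even amount at each step, starting from Φ₃ 0 = 1.
-- (Polynomial identities are stated with Φ₃ unfolded, as the ring solver
-- does not unfold definitions.)
Φ₃-suc : ∀ x → suc x * suc x + suc x + 1 ≡ suc x * 2 + (x * x + x + 1)
Φ₃-suc = solve-∀

Φ₃-odd : ∀ x → ¬ (2 ∣ Φ₃ x)
Φ₃-odd zero 2∣1 with ∣1⇒≡1 2∣1
... | ()
Φ₃-odd (suc x) 2∣Φ₃[1+x] =
  Φ₃-odd x (∣m+n∣m⇒∣n (subst (2 ∣_) (Φ₃-suc x) 2∣Φ₃[1+x]) (n∣m*n (suc x)))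

-- A proper divisor q of an odd number n satisfies 3q ≤ n: its cofactor is
-- neither 0 (n would be even), 1 (n = q), nor 2 (n would be even).
odd-proper-divisor : ∀ {n q} → ¬ (2 ∣ n) → q ∣ n → n ≢ q → 3 * q ≤ n
odd-proper-divisor odd (divides zero refl) n≢q = ⊥-elim (odd (divides 0 refl))
odd-proper-divisor odd (divides 1 refl) n≢q = ⊥-elim (n≢q (+-identityʳ _))
odd-proper-divisor {q = q} odd (divides 2 refl) n≢q = ⊥-elim (odd (divides q (*-comm 2 q)))
odd-proper-divisor {q = q} odd (divides (suc (suc (suc m))) refl) n≢q =
  subst (3 * q ≤_) (sym (*-distribʳ-+ q 3 m)) (m≤m+n (3 * q) (m * q))

-- A perfect square is never prime: 0 and 1 are not prime, and for e ≥ 2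
-- the square e * e has the proper divisor e.
square-not-prime : ∀ e → ¬ Prime (e * e)
square-not-prime zero pr with prime⇒nonTrivial pr
... | ()
square-not-prime (suc zero) pr with prime⇒nonTrivial pr
... | ()
square-not-prime e@(suc (suc k)) pr with prime⇒irreducible pr (m∣m*n e)
... | inj₁ ()
... | inj₂ e≡e*e with *-cancelˡ-≡ 1 e e (trans (*-identityʳ e) e≡e*e)
...   | ()

-- A prime never divides its own Φ₃-value: Φ₃ p ≡ 1 (mod p), so p ∣ Φ₃ p
-- would force p = 1 = 1 * 1.
prime-∤-Φ₃-self : ∀ p → Prime p → ¬ (p ∣ Φ₃ p)
prime-∤-Φ₃-self p pr p∣Φ₃p with ∣1⇒≡1 (∣m+n∣m⇒∣n p∣Φ₃p (∣m∣n⇒∣m+n (m∣m*n p) ∣-refl))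
... | refl = square-not-prime 1 pr

-- Shifting by a multiple of q: q + d ≡ d (mod q), so q ∣ Φ₃ (q + d) ⇒ q ∣ Φ₃ d.
Φ₃-shift-below : ∀ q d → q ∣ Φ₃ (q + d) → q ∣ Φ₃ d
Φ₃-shift-below q d q∣Φ₃[q+d] =
  ∣m+n∣m⇒∣n (subst (q ∣_) expand q∣Φ₃[q+d]) (m∣m*n (q + 2 * d + 1))
  where
  expand : (q + d) * (q + d) + (q + d) + 1 ≡ q * (q + 2 * d + 1) + (d * d + d + 1)
  expand = solve (q ∷ d ∷ [])

-- Reflecting modulo q = p + k + 1: p ≡ -(k + 1) (mod q) and
-- Φ₃ (-(k + 1)) = Φ₃ k, so q ∣ Φ₃ p ⇒ q ∣ Φ₃ k.
Φ₃-shift-above : ∀ p k → suc (p + k) ∣ Φ₃ p → suc (p + k) ∣ Φ₃ k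
Φ₃-shift-above p k q∣Φ₃p =
  ∣m+n∣m⇒∣n (subst (q ∣_) expand (∣m∣n⇒∣m+n q∣Φ₃p (m∣m*n (suc k)))) (m∣m*n (p + 1))
  where
  q = suc (p + k)
  expand : p * p + p + 1 + suc (p + k) * suc k ≡ suc (p + k) * (p + 1) + (k * k + k + 1)
  expand = solve (p ∷ k ∷ [])

-- Case q < p, written p = q + d with d = k + 1.
bound-below : ∀ q k → Prime (suc (q + k)) → q ∣ Φ₃ (suc (q + k)) →
  3 * suc (q + k) < (suc k + 2) * (suc k + 2)
bound-below q k pr q∣Φ₃p = begin-strict
    3 * suc (q + k)    ≡⟨ cong (3 *_) (sym (+-suc q k)) ⟩
    3 * (q + d)        ≡⟨ *-distribˡ-+ 3 q d ⟩
    3 * q + 3 * d      ≤⟨ +-monoˡ-≤ (3 * d) (odd-proper-divisor (Φ₃-odd d) q∣Φ₃d Φ₃d≢q) ⟩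
    Φ₃ d + 3 * d       <⟨ m<m+n (Φ₃ d + 3 * d) {3} (s≤s z≤n) ⟩
    Φ₃ d + 3 * d + 3   ≡⟨ square ⟩
    (d + 2) * (d + 2)  ∎
  where
  open ≤-Reasoning
  d = suc k
  q∣Φ₃d : q ∣ Φ₃ d
  q∣Φ₃d = Φ₃-shift-below q d (subst (λ p → q ∣ Φ₃ p) (sym (+-suc q k)) q∣Φ₃p)
  Φ₃d+d≡square : suc (suc k * suc k + suc k + 1 + k) ≡ suc (suc k) * suc (suc k)
  Φ₃d+d≡square = solve (k ∷ [])
  -- if Φ₃ d = q then p = q + d = Φ₃ d + d = (d + 1)², which is not prime
  Φ₃d≢q : Φ₃ d ≢ q
  Φ₃d≢q Φ₃d≡q = square-not-prime (suc d) (subst Prime p≡square pr)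
    where
    p≡square : suc (q + k) ≡ suc d * suc d
    p≡square = trans (cong (λ x → suc (x + k)) (sym Φ₃d≡q)) Φ₃d+d≡square
  square : suc k * suc k + suc k + 1 + 3 * suc k + 3 ≡ (suc k + 2) * (suc k + 2)
  square = solve (k ∷ [])

-- Case p < q, written q = p + k + 1.
bound-above : ∀ p k → Prime p → suc (p + k) ∣ Φ₃ p →
  3 * p < (suc k + 2) * (suc k + 2)
bound-above p k pr q∣Φ₃p = begin-strict
    3 * p                      <⟨ *-monoʳ-< 3 (s≤s (m≤m+n p k)) ⟩
    3 * q                      ≤⟨ odd-proper-divisor (Φ₃-odd k) (Φ₃-shift-above p k q∣Φ₃p) Φ₃k≢q ⟩
    Φ₃ k                       ≤⟨ m≤m+n (Φ₃ k) (5 * k + 8) ⟩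
    Φ₃ k + (5 * k + 8)         ≡⟨ square ⟩
    (suc k + 2) * (suc k + 2)  ∎
  where
  open ≤-Reasoning
  q = suc (p + k)
  Φ₃k≡suc : k * k + k + 1 ≡ suc (k * k + k)
  Φ₃k≡suc = solve (k ∷ [])
  -- if Φ₃ k = q = p + k + 1 then p = k², which is not prime
  Φ₃k≢q : Φ₃ k ≢ q
  Φ₃k≢q Φ₃k≡q = square-not-prime k (subst Prime p≡k*k pr)
    where
    k*k+k≡p+k : k * k + k ≡ p + k
    k*k+k≡p+k = suc-injective (trans (sym Φ₃k≡suc) Φ₃k≡q)
    p≡k*k : p ≡ k * k
    p≡k*k = sym (+-cancelʳ-≡ k (k * k) p k*k+k≡p+k)
  square : k * k + k + 1 + (5 * k + 8) ≡ (suc k + 2) * (suc k + 2)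
  square = solve (k ∷ [])

distance-shift : ∀ m k → ∣ m - suc (m + k) ∣ ≡ suc k
distance-shift m k = trans (cong ∣ m -_∣ (sym (+-suc m k))) (∣m-m+n∣≡n m (suc k))

mainTheorem4 : (p q : ℕ) → Prime p → ¬ (2 ∣ p) → Prime q → 3 < q → q ∣ p * p + p + 1 →
    3 * p < (∣ p - q ∣ + 2) * (∣ p - q ∣ + 2)
mainTheorem4 p q pr _ _ _ q∣Φ₃p with compare p q
... | less .p k rewrite distance-shift p k = bound-above p k pr q∣Φ₃p
... | equal .p = ⊥-elim (prime-∤-Φ₃-self p pr q∣Φ₃p)
... | greater .q k rewrite ∣-∣-comm (suc (q + k)) q | distance-shift q k =
  bound-below q k pr q∣Φ₃p
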